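{- Let $m\ge2$ and $N=2^m+1$. For $i=1,\dots,|\mathcal{A}_m|$ write $\theta_N(w_i)=w_{F(i)}w_{G(i)}$. Then (1) $F(2i)=F(2i-1)=\tfrac14|\mathcal{A}_m|+i$ for $i=1,\dots,\tfrac12|\mathcal{A}_m|$; (2) $G(i)=\tau(F(i))$ for $i=1,\dots,|\mathcal{A}_m|$, where $\tau(j)=\big((j-1+\tfrac12|\mathcal{A}_m|)\bmod|\mathcal{A}_m|\big)+1$.
   Context: The Thue-Morse substitution is $\theta(0)=01$, $\theta(1)=10$. For $m\ge2$, $\mathcal{A}_m$ is the set of subwords of length $N=2^m+1$ of the Thue-Morse sequence $0110100110010110\dots$ (it has $3\cdot2^m$ elements), listed in lexicographic order (with $0<1$) as $w_1<w_2<\dots<w_{|\mathcal{A}_m|}$. The $N$-block substitution $\theta_N$ on the alphabet $\mathcal{A}_m$ is defined as follows: for $b=a_1\dots a_N\in\mathcal{A}_m$, let $v=v_1\dots v_{2N}=\theta(b)$; then $\theta_N(b)$ is the two-letter word $(v_1\dots v_N)(v_2\dots v_{N+1})$, whose letters are elements of $\mathcal{A}_m$. -}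

module Defs where

open import Data.Bool using (Bool; true; false; not)
open import Data.Nat using (ℕ; zero; suc; _+_; _*_; _∸_; _^_; _/_; _%_)
open import Data.List using (List; []; _∷_; concatMap; take; drop; length; upTo; map)
open import Data.Maybe using (Maybe; just; nothing)
open import Data.Product using (∃)
open import Relation.Binary.PropositionalEquality using (_≡_)

-- Thue-Morse substitution θ(0)=01, θ(1)=10 (0 = false, 1 = true), extended to words.
θ : List Bool → List Bool
θ = concatMap (λ a → a ∷ not a ∷ [])

iterθ : ℕ → List Bool → List Bool
iterθ zero w = w
iterθ (suc k) w = θ (iterθ k w)

-- 0-based indexing with default
at : List Bool → ℕ → Bool
at [] _ = false
at (x ∷ xs) zero = x
at (x ∷ xs) (suc n) = at xs n

-- Thue-Morse sequence t₀ t₁ t₂ … = lim θⁿ(0); θ^(n+1)(0) has length 2^(n+1) > n.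
tm : ℕ → Bool
tm n = at (iterθ (suc n) (false ∷ [])) n

subword : ℕ → ℕ → List Bool
subword n k = map (λ i → tm (k + i)) (upTo n)

blockLen : ℕ → ℕ
blockLen m = 2 ^ m + 1

In𝒜 : ℕ → List Bool → Set
In𝒜 m w = ∃ (λ k → w ≡ subword (blockLen m) k)

-- strict lexicographic order with 0 < 1 (used on words of equal length)
data _<ₗ_ : List Bool → List Bool → Set where
  here  : ∀ {xs ys} → (false ∷ xs) <ₗ (true ∷ ys)
  there : ∀ {b xs ys} → xs <ₗ ys → (b ∷ xs) <ₗ (b ∷ ys)

-- the two letters of θ_N(b): (v₁…v_N) and (v₂…v_{N+1}) where v = θ(b)
θN₁ : ℕ → List Bool → List Bool
θN₁ m b = take (blockLen m) (θ b)

θN₂ : ℕ → List Bool → List Bool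
θN₂ m b = take (blockLen m) (drop 1 (θ b))

-- 1-based indexing: nth ws i = just w_i for 1 ≤ i ≤ |ws|, nothing otherwise
nth : {A : Set} → List A → ℕ → Maybe A
nth [] _ = nothing
nth (x ∷ xs) zero = nothing
nth (x ∷ xs) (suc zero) = just x
nth (x ∷ xs) (suc (suc n)) = nth xs (suc n)

τ : ℕ → ℕ → ℕ
τ zero j = j
τ (suc k) j = ((j ∸ 1 + suc k / 2) % suc k) + 1

module Submission where

-- Put n = 2^(m-1), so N = 2n + 1, and write E n v, O n v for the length-(2n+1) factors of
-- θ(v) starting at positions 0 and 1; thus θ_N(b) = (E n b) (O n b).  Every factor of length
-- 2n+1 is E n v or O n v for a factor v of length n+1 (split at an even or odd position).
-- Let U = A ++ B be the sorted list of length-(n+1) factors, A the words starting with 0,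
-- B those starting with 1, |A| = |B| = c.  Since E n and O n are monotone on such words,
-- no factor begins with three equal letters and n ≥ 2,
--     S = O(B) ++ E(A) ++ E(B) ++ O(A)
-- is the sorted list of length-(2n+1) factors; starting from N = 3 this constructs every
-- level recursively.  A strictly sorted list is determined by its members, so ws = S and
-- |ws| = 4c.  Reading off positions: w_{c+q} = E(u_q), w_{3c+q} = O(u_q) (q ≤ c) and
-- w_r = O(u_{c+r}).  Moreover w_{2i-1} and w_{2i} both have u_i as prefix of length n+1,
-- and E n, O n only look at that prefix, so θ_N(w_{2i-1}) = θ_N(w_{2i}) = E(u_i) O(u_i).
-- Part (1) follows, and part (2) becomes the index identity τ(c+q) = position of O(u_q).

open import Defs
open import Data.Bool using (Bool; true; false; not)
open import Data.Nat using (ℕ; zero; suc; _+_; _*_; _∸_; _^_; _/_; _%_; _≤_; _<_; z≤n; s≤s; _≤?_; ⌈_/2⌉)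
open import Data.Nat.Properties
open import Data.Nat.DivMod using (m*n/n≡m; m<n⇒m%n≡m; [m+n]%n≡m%n)
open import Data.Nat.Tactic.RingSolver using (solve-∀)
open import Data.List using (List; []; _∷_; _++_; length; take; drop; applyUpTo)
import Data.List as List
open import Data.List.Properties using (length-++; length-map; ++-assoc; ++-identityʳ; map-++)
import Data.List.Properties as ListProps
open import Data.List.Relation.Unary.All using (All; []; _∷_)
import Data.List.Relation.Unary.All as All
import Data.List.Relation.Unary.All.Properties as AllProps
open import Data.List.Relation.Unary.Any using (here; there)
open import Data.List.Relation.Unary.AllPairs using (AllPairs; []; _∷_)
import Data.List.Relation.Unary.AllPairs.Properties as AllPairsProps
open import Data.List.Membership.Propositional using (_∈_)
open import Data.List.Membership.Propositional.Properties using (∈-map⁺; ∈-map⁻; ∈-++⁺ˡ; ∈-++⁺ʳ; ∈-++⁻)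
open import Data.Maybe using (just; map)
open import Data.Maybe.Properties using (map-cong)
open import Data.Product using (∃; _,_; _×_; proj₁; proj₂)
open import Data.Sum using (_⊎_; inj₁; inj₂)
open import Data.Empty using (⊥; ⊥-elim)
open import Function.Bundles using (_⇔_; mk⇔; Equivalence)
open import Function.Base using (_∘′_)
open import Relation.Nullary using (¬_; yes; no)
open import Relation.Binary.PropositionalEquality

Word : Set
Word = List Bool

θ-++ : ∀ xs ys → θ (xs ++ ys) ≡ θ xs ++ θ ys
θ-++ [] ys = refl
θ-++ (x ∷ xs) ys = cong (λ z → x ∷ not x ∷ z) (θ-++ xs ys)

length-θ : ∀ w → length (θ w) ≡ length w + length w
length-θ [] = refl
length-θ (x ∷ w) = cong suc (trans (cong suc (length-θ w)) (sym (+-suc (length w) (length w))))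

at-++ : ∀ xs ys i → i < length xs → at (xs ++ ys) i ≡ at xs i
at-++ (x ∷ xs) ys zero _ = refl
at-++ (x ∷ xs) ys (suc i) (s≤s i<xs) = at-++ xs ys i i<xs

at-θ-even : ∀ w i → at (θ w) (i + i) ≡ at w i
at-θ-even [] i = refl
at-θ-even (x ∷ w) zero = refl
at-θ-even (x ∷ w) (suc i) rewrite +-suc i i = at-θ-even w i

at-θ-odd : ∀ w i → i < length w → at (θ w) (suc (i + i)) ≡ not (at w i)
at-θ-odd (x ∷ w) zero _ = refl
at-θ-odd (x ∷ w) (suc i) (s≤s i<w) rewrite +-suc i i = at-θ-odd w i i<w

odd<double : ∀ {n ℓ} → n < ℓ → suc (n + n) < ℓ + ℓ
odd<double {n} {ℓ} n<ℓ = subst (_≤ ℓ + ℓ) (cong suc (+-suc n n)) (+-mono-≤ n<ℓ n<ℓ)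

T : ℕ → Word
T j = iterθ j (false ∷ [])

-- θ^(j+1)(0) = θ^j(01) extends θ^j(0).
T-extends : ∀ j → ∃ λ r → T (suc j) ≡ T j ++ r
T-extends zero = true ∷ [] , refl
T-extends (suc j) with T-extends j
... | r , eq = θ r , trans (cong θ eq) (θ-++ (T j) r)

T-prefix : ∀ d j → ∃ λ r → T (d + j) ≡ T j ++ r
T-prefix zero j = [] , sym (++-identityʳ (T j))
T-prefix (suc d) j with T-prefix d j | T-extends (d + j)
... | r , eq | r′ , eq′ = r ++ r′ , trans eq′ (trans (cong (_++ r′) eq) (++-assoc (T j) r r′))

T-long : ∀ j → j < length (T j)
T-long zero = s≤s z≤n
T-long (suc j) = subst (suc j <_) (sym (length-θ (T j)))
  (+-mono-≤ (≤-trans (s≤s z≤n) (T-long j)) (T-long j))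

T-long-suc : ∀ i → i < length (T (suc i))
T-long-suc i = <-trans (n<1+n i) (T-long (suc i))

-- Any prefix T j that reaches position i computes tm i: compare both with a common extension.
tm-at : ∀ j i → i < length (T j) → tm i ≡ at (T j) i
tm-at j i i<Tj with T-prefix (suc i) j | T-prefix j (suc i)
... | r , eq | r′ , eq′ = begin
    at (T (suc i)) i         ≡⟨ sym (at-++ (T (suc i)) r′ i (T-long-suc i)) ⟩
    at (T (suc i) ++ r′) i   ≡⟨ cong (λ z → at z i) (sym eq′) ⟩
    at (T (j + suc i)) i     ≡⟨ cong (λ d → at (T d) i) (+-comm j (suc i)) ⟩
    at (T (suc i + j)) i     ≡⟨ cong (λ z → at z i) eq ⟩
    at (T j ++ r) i          ≡⟨ at-++ (T j) r i i<Tj ⟩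
    at (T j) i               ∎
  where open ≡-Reasoning

tm-double : ∀ n → tm (n + n) ≡ tm n
tm-double n = trans (tm-at (suc (suc n)) (n + n) n+n<) (at-θ-even (T (suc n)) n)
  where
  n+n< : n + n < length (T (suc (suc n)))
  n+n< = subst (n + n <_) (sym (length-θ (T (suc n))))
           (<-trans (n<1+n (n + n)) (odd<double (T-long-suc n)))

tm-double+1 : ∀ n → tm (suc (n + n)) ≡ not (tm n)
tm-double+1 n = trans (tm-at (suc (suc n)) (suc (n + n)) 2n+1<)
                      (at-θ-odd (T (suc n)) n (T-long-suc n))
  where
  2n+1< : suc (n + n) < length (T (suc (suc n)))
  2n+1< = subst (suc (n + n) <_) (sym (length-θ (T (suc n)))) (odd<double (T-long-suc n))

-- factor n k is the length-n factor of the Thue–Morse sequence at position k; it is the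
-- structurally recursive form of `subword`.
factor : ℕ → ℕ → Word
factor zero k = []
factor (suc n) k = tm k ∷ factor n (suc k)

tabulation-factor : ∀ n k (f : ℕ → Bool) (g : ℕ → ℕ) → (∀ i → f (g i) ≡ tm (k + i)) →
  List.map f (applyUpTo g n) ≡ factor n k
tabulation-factor zero k f g fg = refl
tabulation-factor (suc n) k f g fg = cong₂ _∷_ (trans (fg 0) (cong tm (+-identityʳ k)))
  (tabulation-factor n (suc k) f (λ i → g (suc i)) (λ i → trans (fg (suc i)) (cong tm (+-suc k i))))

subword≡factor : ∀ n k → subword n k ≡ factor n k
subword≡factor n k = tabulation-factor n k (λ i → tm (k + i)) (λ i → i) (λ i → refl)

θ-factor : ∀ n k → θ (factor n k) ≡ factor (n + n) (k + k)
θ-factor zero k = refl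
θ-factor (suc n) k
  rewrite +-suc n n | tm-double k | tm-double+1 k | θ-factor n (suc k) | +-suc k k = refl

take-factor : ∀ a b k → a ≤ b → take a (factor b k) ≡ factor a k
take-factor zero b k _ = refl
take-factor (suc a) (suc b) k (s≤s a≤b) = cong (tm k ∷_) (take-factor a b (suc k) a≤b)

take-take-≤ : ∀ {a b} (x : Word) → a ≤ b → take a (take b x) ≡ take a x
take-take-≤ {a} {b} x a≤b = trans (ListProps.take-take a b x) (cong (λ k → take k x) (m≤n⇒m⊓n≡m a≤b))

parity : ∀ k → ∃ λ q → k ≡ q + q ⊎ k ≡ suc (q + q)
parity zero = 0 , inj₁ refl
parity (suc k) with parity k
... | q , inj₁ eq = q , inj₂ (cong suc eq)
... | q , inj₂ eq = suc q , inj₁ (cong suc (trans eq (sym (+-suc q q))))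

-- v is a Thue–Morse factor of length n + 1.
Factor : ℕ → Word → Set
Factor n v = ∃ λ k → v ≡ factor (suc n) k

blockLen≡ : ∀ M → blockLen M ≡ suc (2 ^ M)
blockLen≡ M = +-comm (2 ^ M) 1

blockLen-suc≡ : ∀ M → blockLen (suc M) ≡ suc (2 ^ M + 2 ^ M)
blockLen-suc≡ M = trans (blockLen≡ (suc M)) (cong (λ k → suc (2 ^ M + k)) (+-identityʳ (2 ^ M)))

In𝒜⇔Factor : ∀ M v → In𝒜 M v ⇔ Factor (2 ^ M) v
In𝒜⇔Factor M v = mk⇔ (λ { (k , eq) → k , trans eq (block≡ k) })
                      (λ { (k , eq) → k , trans eq (sym (block≡ k)) })
  where
  block≡ : ∀ k → subword (blockLen M) k ≡ factor (suc (2 ^ M)) k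
  block≡ k = trans (subword≡factor _ k) (cong (λ z → factor z k) (blockLen≡ M))

E O : ℕ → Word → Word
E n v = take (suc (n + n)) (θ v)
O n v = take (suc (n + n)) (drop 1 (θ v))

θN₁≡E : ∀ M v → θN₁ (suc M) v ≡ E (2 ^ M) v
θN₁≡E M v = cong (λ z → take z (θ v)) (blockLen-suc≡ M)

θN₂≡O : ∀ M v → θN₂ (suc M) v ≡ O (2 ^ M) v
θN₂≡O M v = cong (λ z → take z (drop 1 (θ v))) (blockLen-suc≡ M)

E-factor : ∀ n q → E n (factor (suc n) q) ≡ factor (suc (n + n)) (q + q)
E-factor n q = trans (cong (take (suc (n + n))) (θ-factor (suc n) q))
  (take-factor (suc (n + n)) (suc (n + suc n)) (q + q) (s≤s (+-monoʳ-≤ n (n≤1+n n))))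

O-factor : ∀ n q → O n (factor (suc n) q) ≡ factor (suc (n + n)) (suc (q + q))
O-factor n q = trans (cong (λ z → take (suc (n + n)) (drop 1 z)) (θ-factor (suc n) q))
  (take-factor (suc (n + n)) (n + suc n) (suc (q + q)) (≤-reflexive (sym (+-suc n n))))

Factor-E : ∀ n v → Factor n v → Factor (n + n) (E n v)
Factor-E n v (q , refl) = q + q , E-factor n q

Factor-O : ∀ n v → Factor n v → Factor (n + n) (O n v)
Factor-O n v (q , refl) = suc (q + q) , O-factor n q

-- Conversely every factor of length 2n + 1 is E or O of a factor of length n + 1,
-- according to the parity of its position.
Factor-split : ∀ n w → Factor (n + n) w → ∃ λ v → Factor n v × (w ≡ E n v ⊎ w ≡ O n v)
Factor-split n w (k , eq) with parity k
... | q , inj₁ refl = factor (suc n) q , (q , refl) , inj₁ (trans eq (sym (E-factor n q)))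
... | q , inj₂ refl = factor (suc n) q , (q , refl) , inj₂ (trans eq (sym (O-factor n q)))

<ₗ-trans : ∀ {x y z} → x <ₗ y → y <ₗ z → x <ₗ z
<ₗ-trans here (there q) = here
<ₗ-trans (there p) here = here
<ₗ-trans (there p) (there q) = there (<ₗ-trans p q)

<ₗ-irrefl : ∀ {x} → ¬ (x <ₗ x)
<ₗ-irrefl (there p) = <ₗ-irrefl p

θ-mono : ∀ {x y} → x <ₗ y → θ x <ₗ θ y
θ-mono here = here
θ-mono (there p) = there (there (θ-mono p))

-- Truncating to at least the length of x keeps the position where x and y first differ.
take-mono : ∀ {x y} n → x <ₗ y → length x ≤ n → take n x <ₗ take n y
take-mono (suc n) here _ = here
take-mono (suc n) (there p) (s≤s x≤n) = there (take-mono n p x≤n)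

prefix-< : ∀ {x y} k → take k x <ₗ take k y → x <ₗ y
prefix-< {_ ∷ _} {_ ∷ _} (suc k) here = here
prefix-< {_ ∷ _} {_ ∷ _} (suc k) (there p) = there (prefix-< k p)

length-take-≤ : ∀ k (x : Word) → k ≤ length x → length (take k x) ≡ k
length-take-≤ k x k≤x = trans (ListProps.length-take k x) (m≤n⇒m⊓n≡m k≤x)

-- The words of one level: length n + 1, first letter b, and the first three letters are not
-- all equal (the Thue–Morse sequence has no factor 000 or 111).
Starts : Bool → Word → Set
Starts b [] = ⊥
Starts b (x ∷ _) = x ≡ b

MixedStart : Word → Set
MixedStart (a ∷ b ∷ c ∷ _) = ¬ (a ≡ b × b ≡ c)
MixedStart _ = ⊥

Shaped : Bool → ℕ → Word → Set
Shaped b n x = Starts b x × length x ≡ suc n × MixedStart x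

a≢not-a : ∀ {a} → ¬ (a ≡ not a)
a≢not-a {true} ()
a≢not-a {false} ()

starts-< : ∀ {x y} → Starts false x → Starts true y → x <ₗ y
starts-< {false ∷ _} {true ∷ _} refl refl = here

four≤ : ∀ n → 2 ≤ n → 4 ≤ suc (n + n)
four≤ n 2≤n = s≤s (+-mono-≤ 2≤n (≤-trans (s≤s z≤n) 2≤n))

take-E : ∀ {n} k v → 2 ≤ n → k ≤ 4 → take k (E n v) ≡ take k (θ v)
take-E {n} k v 2≤n k≤4 = take-take-≤ (θ v) (≤-trans k≤4 (four≤ n 2≤n))

take-O : ∀ {n} k v → 2 ≤ n → k ≤ 4 → take k (O n v) ≡ take k (drop 1 (θ v))
take-O {n} k v 2≤n k≤4 = take-take-≤ (drop 1 (θ v)) (≤-trans k≤4 (four≤ n 2≤n))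

mixed-take : ∀ x → MixedStart (take 3 x) → MixedStart x
mixed-take (a ∷ b ∷ c ∷ x) mixed = mixed

Shaped-E : ∀ {b n x} → 2 ≤ n → Shaped b n x → Shaped b (n + n) (E n x)
Shaped-E {b} {n} {x@(a ∷ c ∷ _ ∷ _)} 2≤n (refl , len , _) = refl , length-E , mixed
  where
  length-E : length (E n x) ≡ suc (n + n)
  length-E = length-take-≤ (suc (n + n)) (θ x)
    (subst (suc (n + n) ≤_) (sym (trans (length-θ x) (cong₂ _+_ len len)))
      (s≤s (+-monoʳ-≤ n (n≤1+n n))))
  mixed : MixedStart (E n x)
  mixed = mixed-take (E n x)
    (subst MixedStart (sym (take-E 3 x 2≤n (n≤1+n 3))) (λ { (a≡¬a , _) → a≢not-a a≡¬a }))

Shaped-O : ∀ {b n x} → 2 ≤ n → Shaped b n x → Shaped (not b) (n + n) (O n x)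
Shaped-O {b} {n} {x@(a ∷ c ∷ xs)} 2≤n (refl , len , _) = refl , length-O , mixed
  where
  length-O : length (O n x) ≡ suc (n + n)
  length-O = cong suc (length-take-≤ (n + n) (θ (c ∷ xs))
    (≤-reflexive (sym (trans (length-θ (c ∷ xs)) (cong₂ _+_ len′ len′)))))
    where
    len′ : length (c ∷ xs) ≡ n
    len′ = suc-injective len
  mixed : MixedStart (O n x)
  mixed = mixed-take (O n x)
    (subst MixedStart (sym (take-O 3 x 2≤n (n≤1+n 3))) (λ { (_ , c≡¬c) → a≢not-a c≡¬c }))

E-cons : ∀ n b xs → E (suc n) (b ∷ xs) ≡ b ∷ not b ∷ E n xs
E-cons n b xs = cong (λ k → b ∷ not b ∷ take k (θ xs)) (+-suc n n)

E-mono-length : ∀ n {x y} → x <ₗ y → length x ≡ suc n → E n x <ₗ E n y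
E-mono-length n here _ = here
E-mono-length zero (there here) ()
E-mono-length zero (there (there p)) ()
E-mono-length (suc n) (there {b} {xs} {ys} p) len =
  subst₂ _<ₗ_ (sym (E-cons n b xs)) (sym (E-cons n b ys))
    (there (there (E-mono-length n p (suc-injective len))))

E-mono : ∀ {b n x y} → Shaped b n x → Shaped b n y → x <ₗ y → E n x <ₗ E n y
E-mono {n = n} (_ , len , _) _ x<y = E-mono-length n x<y len

O-mono : ∀ {b n x y} → Shaped b n x → Shaped b n y → x <ₗ y → O n x <ₗ O n y
O-mono {n = n} {_ ∷ xs} {_ ∷ _} (refl , len , _) (refl , _ , _) (there p) =
  there (take-mono (n + n) (θ-mono p)
    (≤-reflexive (trans (length-θ xs) (cong₂ _+_ (suc-injective len) (suc-injective len)))))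

-- The two comparisons between blocks that do not follow from first letters: for u starting
-- with 1 and v starting with 0, O n u < E n v, and symmetrically E n v′ < O n u′.  They are
-- decided within the first four letters, using that u does not begin with 111 (resp. 000).
O<E-four : ∀ u₂ u₃ v₂ → MixedStart (true ∷ u₂ ∷ u₃ ∷ []) →
  (false ∷ u₂ ∷ not u₂ ∷ u₃ ∷ []) <ₗ (false ∷ true ∷ v₂ ∷ not v₂ ∷ [])
O<E-four false u₃ v₂ _ = there here
O<E-four true false true _ = there (there here)
O<E-four true false false _ = there (there (there here))
O<E-four true true v₂ mixed = ⊥-elim (mixed (refl , refl))

E<O-four : ∀ u₂ u₃ v₂ → MixedStart (false ∷ u₂ ∷ u₃ ∷ []) →
  (true ∷ false ∷ v₂ ∷ not v₂ ∷ []) <ₗ (true ∷ u₂ ∷ not u₂ ∷ u₃ ∷ [])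
E<O-four true u₃ v₂ _ = there here
E<O-four false true false _ = there (there here)
E<O-four false true true _ = there (there (there here))
E<O-four false false v₂ mixed = ⊥-elim (mixed (refl , refl))

O<E : ∀ {n u v} → 2 ≤ n → Shaped true n u → Shaped false n v → O n u <ₗ E n v
O<E {n} {u@(true ∷ u₂ ∷ u₃ ∷ _)} {v@(false ∷ v₂ ∷ _ ∷ _)} 2≤n (refl , _ , mixed) (refl , _ , _) =
  prefix-< 4 (subst₂ _<ₗ_ (sym (take-O 4 u 2≤n ≤-refl)) (sym (take-E 4 v 2≤n ≤-refl))
    (O<E-four u₂ u₃ v₂ mixed))

E<O : ∀ {n u v} → 2 ≤ n → Shaped false n u → Shaped true n v → E n v <ₗ O n u
E<O {n} {u@(false ∷ u₂ ∷ u₃ ∷ _)} {v@(true ∷ v₂ ∷ _ ∷ _)} 2≤n (refl , _ , mixed) (refl , _ , _) =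
  prefix-< 4 (subst₂ _<ₗ_ (sym (take-E 4 v 2≤n ≤-refl)) (sym (take-O 4 u 2≤n ≤-refl))
    (E<O-four u₂ u₃ v₂ mixed))

module _ {A : Set} where

  nth-map : ∀ {B : Set} (f : A → B) xs i → nth (List.map f xs) i ≡ map f (nth xs i)
  nth-map f [] i = refl
  nth-map f (x ∷ xs) zero = refl
  nth-map f (x ∷ xs) (suc zero) = refl
  nth-map f (x ∷ xs) (suc (suc i)) = nth-map f xs (suc i)

  nth-++ˡ : ∀ (xs ys : List A) i → i ≤ length xs → nth (xs ++ ys) i ≡ nth xs i
  nth-++ˡ [] [] zero _ = refl
  nth-++ˡ [] (y ∷ ys) zero _ = refl
  nth-++ˡ (x ∷ xs) ys zero _ = refl
  nth-++ˡ (x ∷ xs) ys (suc zero) _ = refl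
  nth-++ˡ (x ∷ xs) ys (suc (suc i)) (s≤s i≤xs) = nth-++ˡ xs ys (suc i) i≤xs

  nth-++ʳ : ∀ (xs ys : List A) j → nth (xs ++ ys) (length xs + suc j) ≡ nth ys (suc j)
  nth-++ʳ [] ys j = refl
  nth-++ʳ (x ∷ xs) ys j rewrite +-suc (length xs) j =
    trans (cong (nth (xs ++ ys)) (sym (+-suc (length xs) j))) (nth-++ʳ xs ys j)

  nth-defined : ∀ (xs : List A) i → 1 ≤ i → i ≤ length xs → ∃ λ x → nth xs i ≡ just x
  nth-defined (x ∷ xs) (suc zero) _ _ = x , refl
  nth-defined (x ∷ xs) (suc (suc i)) _ (s≤s i≤xs) = nth-defined xs (suc i) (s≤s z≤n) i≤xs

  nth-∈ : ∀ (xs : List A) i {x} → nth xs i ≡ just x → x ∈ xs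
  nth-∈ (x ∷ xs) (suc zero) refl = here refl
  nth-∈ (x ∷ xs) (suc (suc i)) eq = there (nth-∈ xs (suc i) eq)

  sorted-map : ∀ {P : A → Set} {_≺_ : A → A → Set} (f : A → A) →
    (∀ {x y} → P x → P y → x ≺ y → f x ≺ f y) →
    ∀ {xs} → All P xs → AllPairs _≺_ xs → AllPairs _≺_ (List.map f xs)
  sorted-map f mono [] [] = []
  sorted-map f mono (px ∷ pxs) (x≺xs ∷ sorted) =
    AllProps.map⁺ (All.zipWith (λ { (py , x≺y) → mono px py x≺y }) (pxs , x≺xs)) ∷
    sorted-map f mono pxs sorted

  all-below : ∀ {P Q : A → Set} {_≺_ : A → A → Set} → (∀ {x y} → P x → Q y → x ≺ y) →
    ∀ {xs ys} → All P xs → All Q ys → All (λ x → All (x ≺_) ys) xs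
  all-below below pxs qys = All.map (λ px → All.map (below px) qys) pxs

  module StrictlySorted {_≺_ : A → A → Set}
    (≺-irrefl : ∀ {x} → ¬ (x ≺ x)) (≺-trans : ∀ {x y z} → x ≺ y → y ≺ z → x ≺ z) where

    sorted-unique : ∀ xs ys → AllPairs _≺_ xs → AllPairs _≺_ ys →
      (∀ w → w ∈ xs → w ∈ ys) → (∀ w → w ∈ ys → w ∈ xs) → xs ≡ ys
    sorted-unique [] [] _ _ _ _ = refl
    sorted-unique [] (y ∷ ys) _ _ _ ys⊆xs with ys⊆xs y (here refl)
    ... | ()
    sorted-unique (x ∷ xs) [] _ _ xs⊆ys _ with xs⊆ys x (here refl)
    ... | ()
    sorted-unique (x ∷ xs) (y ∷ ys) (x≺xs ∷ sxs) (y≺ys ∷ sys) xs⊆ys ys⊆xs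
      with xs⊆ys x (here refl) | ys⊆xs y (here refl)
    ... | there x∈ys | here refl = ⊥-elim (≺-irrefl (All.lookup y≺ys x∈ys))
    ... | there x∈ys | there y∈xs = ⊥-elim (≺-irrefl (≺-trans (All.lookup y≺ys x∈ys) (All.lookup x≺xs y∈xs)))
    ... | here refl | _ = cong (x ∷_) (sorted-unique xs ys sxs sys (tail-⊆ x≺xs xs⊆ys) (tail-⊆ y≺ys ys⊆xs))
      where
      -- dropping the common head x keeps the inclusion, as x is not in either tail
      tail-⊆ : ∀ {us vs} → All (x ≺_) us → (∀ w → w ∈ x ∷ us → w ∈ x ∷ vs) → ∀ w → w ∈ us → w ∈ vs
      tail-⊆ x≺us us⊆vs w w∈us with us⊆vs w (there w∈us)
      ... | here refl = ⊥-elim (≺-irrefl (All.lookup x≺us w∈us))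
      ... | there w∈vs = w∈vs

    nth-injective : ∀ xs i j {w} → AllPairs _≺_ xs → nth xs i ≡ just w → nth xs j ≡ just w → i ≡ j
    nth-injective (x ∷ xs) (suc zero) (suc zero) _ _ _ = refl
    nth-injective (x ∷ xs) (suc zero) (suc (suc j)) (x≺xs ∷ _) refl eq =
      ⊥-elim (≺-irrefl (All.lookup x≺xs (nth-∈ xs (suc j) eq)))
    nth-injective (x ∷ xs) (suc (suc i)) (suc zero) (x≺xs ∷ _) eq refl =
      ⊥-elim (≺-irrefl (All.lookup x≺xs (nth-∈ xs (suc i) eq)))
    nth-injective (x ∷ xs) (suc (suc i)) (suc (suc j)) (_ ∷ sorted) eqi eqj =
      cong suc (nth-injective xs (suc i) (suc j) sorted eqi eqj)

open StrictlySorted {A = Word} {_≺_ = _<ₗ_} <ₗ-irrefl <ₗ-trans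

module _ {A : Set} (f g : A → A) (xs ys : List A) where

  four-blocks : List A
  four-blocks = (List.map g ys ++ List.map f xs) ++ (List.map f ys ++ List.map g xs)

  private
    image : ∀ {w} (h : A → A) {zs} → (∀ {v} → v ∈ zs → v ∈ xs ++ ys) →
      (∀ {v} → w ≡ h v → w ≡ f v ⊎ w ≡ g v) → w ∈ List.map h zs →
      ∃ λ v → v ∈ xs ++ ys × (w ≡ f v ⊎ w ≡ g v)
    image h inc which w∈ with ∈-map⁻ h w∈
    ... | v , v∈zs , eq = v , inc v∈zs , which eq

  four-blocks-∈⁻ : ∀ {w} → w ∈ four-blocks → ∃ λ v → v ∈ xs ++ ys × (w ≡ f v ⊎ w ≡ g v)
  four-blocks-∈⁻ w∈ with ∈-++⁻ (List.map g ys ++ List.map f xs) w∈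
  ... | inj₁ w∈₁ with ∈-++⁻ (List.map g ys) w∈₁
  ...   | inj₁ w∈gys = image g (∈-++⁺ʳ xs) inj₂ w∈gys
  ...   | inj₂ w∈fxs = image f ∈-++⁺ˡ inj₁ w∈fxs
  four-blocks-∈⁻ w∈ | inj₂ w∈₂ with ∈-++⁻ (List.map f ys) w∈₂
  ...   | inj₁ w∈fys = image f (∈-++⁺ʳ xs) inj₁ w∈fys
  ...   | inj₂ w∈gxs = image g ∈-++⁺ˡ inj₂ w∈gxs

  four-blocks-∈⁺ : ∀ {v w} → v ∈ xs ++ ys → (w ≡ f v ⊎ w ≡ g v) → w ∈ four-blocks
  four-blocks-∈⁺ v∈ which with ∈-++⁻ xs v∈ | which
  ... | inj₁ v∈xs | inj₁ refl = ∈-++⁺ˡ (∈-++⁺ʳ (List.map g ys) (∈-map⁺ f v∈xs))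
  ... | inj₁ v∈xs | inj₂ refl = ∈-++⁺ʳ (List.map g ys ++ List.map f xs) (∈-++⁺ʳ (List.map f ys) (∈-map⁺ g v∈xs))
  ... | inj₂ v∈ys | inj₁ refl = ∈-++⁺ʳ (List.map g ys ++ List.map f xs) (∈-++⁺ˡ (∈-map⁺ f v∈ys))
  ... | inj₂ v∈ys | inj₂ refl = ∈-++⁺ˡ (∈-++⁺ˡ (∈-map⁺ g v∈ys))

record SortedLevel (n : ℕ) (A B : List Word) : Set where
  field
    shapedA : All (Shaped false n) A
    shapedB : All (Shaped true n) B
    sortedA : AllPairs _<ₗ_ A
    sortedB : AllPairs _<ₗ_ B
    balanced : length A ≡ length B
    sound : ∀ w → w ∈ A ++ B → Factor n w
    complete : ∀ w → Factor n w → w ∈ A ++ B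

  sorted : AllPairs _<ₗ_ (A ++ B)
  sorted = AllPairsProps.++⁺ sortedA sortedB
    (all-below starts-< (All.map proj₁ shapedA) (All.map proj₁ shapedB))

nextA nextB : ℕ → List Word → List Word → List Word
nextA n A B = List.map (O n) B ++ List.map (E n) A
nextB n A B = List.map (E n) B ++ List.map (O n) A

next-level : ∀ n A B → 2 ≤ n → SortedLevel n A B → SortedLevel (n + n) (nextA n A B) (nextB n A B)
next-level n A B 2≤n level = record
  { shapedA = AllProps.++⁺ (shaped-O shapedB) (shaped-E shapedA)
  ; shapedB = AllProps.++⁺ (shaped-E shapedB) (shaped-O shapedA)
  ; sortedA = AllPairsProps.++⁺ (sorted-map (O n) O-mono shapedB sortedB) (sorted-map (E n) E-mono shapedA sortedA)
      (blocks-below (O n) (E n) (O<E 2≤n) shapedB shapedA)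
  ; sortedB = AllPairsProps.++⁺ (sorted-map (E n) E-mono shapedB sortedB) (sorted-map (O n) O-mono shapedA sortedA)
      (blocks-below (E n) (O n) (λ v u → E<O 2≤n u v) shapedB shapedA)
  ; balanced = trans (length-blocks (O n) (E n) B A) (sym (length-blocks (E n) (O n) B A))
  ; sound = λ w w∈ → next-sound (four-blocks-∈⁻ (E n) (O n) A B w∈)
  ; complete = λ w w-factor → next-complete (Factor-split n w w-factor)
  }
  where
  open SortedLevel level
  shaped-E : ∀ {b X} → All (Shaped b n) X → All (Shaped b (n + n)) (List.map (E n) X)
  shaped-E = AllProps.map⁺ ∘′ All.map (Shaped-E 2≤n)
  shaped-O : ∀ {b X} → All (Shaped b n) X → All (Shaped (not b) (n + n)) (List.map (O n) X)
  shaped-O = AllProps.map⁺ ∘′ All.map (Shaped-O 2≤n)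
  blocks-below : ∀ {P Q : Word → Set} (f g : Word → Word) → (∀ {u v} → P u → Q v → f u <ₗ g v) →
    ∀ {X Y} → All P X → All Q Y → All (λ x → All (x <ₗ_) (List.map g Y)) (List.map f X)
  blocks-below f g below px qy =
    AllProps.map⁺ (All.map AllProps.map⁺ (all-below {_≺_ = λ u v → f u <ₗ g v} below px qy))
  length-blocks : ∀ (f g : Word → Word) X Y → length (List.map f X ++ List.map g Y) ≡ length X + length Y
  length-blocks f g X Y = trans (length-++ (List.map f X)) (cong₂ _+_ (length-map f X) (length-map g Y))
  next-sound : ∀ {w} → (∃ λ v → v ∈ A ++ B × (w ≡ E n v ⊎ w ≡ O n v)) → Factor (n + n) w
  next-sound (v , v∈ , inj₁ refl) = Factor-E n v (sound v v∈)
  next-sound (v , v∈ , inj₂ refl) = Factor-O n v (sound v v∈)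
  next-complete : ∀ {w} → (∃ λ v → Factor n v × (w ≡ E n v ⊎ w ≡ O n v)) →
    w ∈ nextA n A B ++ nextB n A B
  next-complete (v , v-factor , which) = four-blocks-∈⁺ (E n) (O n) A B (complete v v-factor) which

baseA baseB : List Word
baseA = (false ∷ false ∷ true ∷ []) ∷ (false ∷ true ∷ false ∷ []) ∷ (false ∷ true ∷ true ∷ []) ∷ []
baseB = (true ∷ false ∷ false ∷ []) ∷ (true ∷ false ∷ true ∷ []) ∷ (true ∷ true ∷ false ∷ []) ∷ []

-- The Thue–Morse sequence has no factor 000 or 111 (look at the positions modulo 2).
no-cube : ∀ k → ¬ (tm k ≡ tm (suc k) × tm (suc k) ≡ tm (suc (suc k)))
no-cube k (p , q) with parity k
... | x , inj₁ refl = a≢not-a (trans (sym (tm-double x)) (trans p (tm-double+1 x)))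
... | x , inj₂ refl = a≢not-a (trans (sym tm-2x+2) (trans q tm-2x+3))
  where
  tm-2x+2 : tm (suc (suc (x + x))) ≡ tm (suc x)
  tm-2x+2 = trans (cong tm (sym (+-suc (suc x) x))) (tm-double (suc x))
  tm-2x+3 : tm (suc (suc (suc (x + x)))) ≡ not (tm (suc x))
  tm-2x+3 = trans (cong (tm ∘′ suc) (sym (+-suc (suc x) x))) (tm-double+1 (suc x))

base-complete : ∀ a b c → ¬ (a ≡ b × b ≡ c) → (a ∷ b ∷ c ∷ []) ∈ baseA ++ baseB
base-complete false false false mixed = ⊥-elim (mixed (refl , refl))
base-complete false false true _ = here refl
base-complete false true false _ = there (here refl)
base-complete false true true _ = there (there (here refl))
base-complete true false false _ = there (there (there (here refl)))
base-complete true false true _ = there (there (there (there (here refl))))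
base-complete true true false _ = there (there (there (there (there (here refl)))))
base-complete true true true mixed = ⊥-elim (mixed (refl , refl))

-- Each base word together with a position where it occurs in 0110100110….
base-sound : ∀ w → w ∈ baseA ++ baseB → Factor 2 w
base-sound w (here refl) = 5 , refl
base-sound w (there (here refl)) = 3 , refl
base-sound w (there (there (here refl))) = 0 , refl
base-sound w (there (there (there (here refl)))) = 4 , refl
base-sound w (there (there (there (there (here refl))))) = 2 , refl
base-sound w (there (there (there (there (there (here refl)))))) = 1 , refl

base-level : SortedLevel 2 baseA baseB
base-level = record
  { shapedA = (refl , refl , λ { (_ , ()) }) ∷ (refl , refl , λ { (() , _) }) ∷ (refl , refl , λ { (() , _) }) ∷ []
  ; shapedB = (refl , refl , λ { (() , _) }) ∷ (refl , refl , λ { (() , _) }) ∷ (refl , refl , λ { (_ , ()) }) ∷ []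
  ; sortedA = (there here ∷ there here ∷ []) ∷ (there (there here) ∷ []) ∷ [] ∷ []
  ; sortedB = (there (there here) ∷ there here ∷ []) ∷ (there here ∷ []) ∷ [] ∷ []
  ; balanced = refl
  ; sound = base-sound
  ; complete = λ { w (k , refl) → base-complete (tm k) (tm (suc k)) (tm (suc (suc k))) (no-cube k) }
  }

-- Level k consists of the factors of length size k + 1, where size k = 2^(k+1).
size : ℕ → ℕ
size zero = 2
size (suc k) = size k + size k

size≡ : ∀ k → size k ≡ 2 ^ suc k
size≡ zero = refl
size≡ (suc k) = trans (cong₂ _+_ (size≡ k) (size≡ k)) (cong (2 ^ suc k +_) (sym (+-identityʳ (2 ^ suc k))))

2≤size : ∀ k → 2 ≤ size k
2≤size zero = ≤-refl
2≤size (suc k) = ≤-trans (2≤size k) (m≤m+n _ _)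

levelA levelB : ℕ → List Word
levelA zero = baseA
levelA (suc k) = nextA (size k) (levelA k) (levelB k)
levelB zero = baseB
levelB (suc k) = nextB (size k) (levelA k) (levelB k)

sorted-level : ∀ k → SortedLevel (size k) (levelA k) (levelB k)
sorted-level zero = base-level
sorted-level (suc k) = next-level (size k) _ _ (2≤size k) (sorted-level k)

θ-take : ∀ a (v : Word) → θ (take a v) ≡ take (a + a) (θ v)
θ-take zero v = refl
θ-take (suc a) [] = refl
θ-take (suc a) (x ∷ v) rewrite +-suc a a = cong (λ z → x ∷ not x ∷ z) (θ-take a v)

2n+1≤ : ∀ n → suc (n + n) ≤ n + suc n
2n+1≤ n = ≤-reflexive (sym (+-suc n n))

E-prefix : ∀ n v → E n v ≡ E n (take (suc n) v)
E-prefix n v = sym (begin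
    take (suc (n + n)) (θ (take (suc n) v))         ≡⟨ cong (take (suc (n + n))) (θ-take (suc n) v) ⟩
    take (suc (n + n)) (take (suc n + suc n) (θ v))  ≡⟨ take-take-≤ (θ v) (m≤n⇒m≤1+n (2n+1≤ n)) ⟩
    take (suc (n + n)) (θ v)                         ∎)
  where open ≡-Reasoning

O-prefix : ∀ n v → O n v ≡ O n (take (suc n) v)
O-prefix n v = sym (begin
      take (suc (n + n)) (drop 1 (θ (take (suc n) v)))
    ≡⟨ cong (λ z → take (suc (n + n)) (drop 1 z)) (θ-take (suc n) v) ⟩
      take (suc (n + n)) (drop 1 (take (suc n + suc n) (θ v)))
    ≡⟨ cong (take (suc (n + n))) (sym (ListProps.take-drop (n + suc n) 1 (θ v))) ⟩
      take (suc (n + n)) (take (n + suc n) (drop 1 (θ v)))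
    ≡⟨ take-take-≤ (drop 1 (θ v)) (2n+1≤ n) ⟩
      take (suc (n + n)) (drop 1 (θ v))
    ∎)
  where open ≡-Reasoning

E-truncate : ∀ n v → take (suc (n + n)) (E (n + n) v) ≡ E n (take (suc n) v)
E-truncate n v = trans (take-take-≤ (θ v) (s≤s (m≤m+n _ _))) (E-prefix n v)

O-truncate : ∀ n v → take (suc (n + n)) (O (n + n) v) ≡ O n (take (suc n) v)
O-truncate n v = trans (take-take-≤ (drop 1 (θ v)) (s≤s (m≤m+n _ _))) (O-prefix n v)

data Doubled (p : Word → Word) : List Word → List Word → Set where
  [] : Doubled p [] []
  pair : ∀ {u x y us ws} → p x ≡ u → p y ≡ u → Doubled p us ws → Doubled p (u ∷ us) (x ∷ y ∷ ws)

Doubled-++ : ∀ {p us us′ ws ws′} → Doubled p us ws → Doubled p us′ ws′ → Doubled p (us ++ us′) (ws ++ ws′)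
Doubled-++ [] d′ = d′
Doubled-++ (pair px py d) d′ = pair px py (Doubled-++ d d′)

Doubled-map : ∀ {p p′ : Word → Word} (f g : Word → Word) → (∀ x → p (f x) ≡ g (p′ x)) → ∀ {us ws} →
  Doubled p′ us ws → Doubled p (List.map g us) (List.map f ws)
Doubled-map f g comm [] = []
Doubled-map f g comm (pair {x = x} {y = y} px py d) =
  pair (trans (comm x) (cong g px)) (trans (comm y) (cong g py)) (Doubled-map f g comm d)

level-doubled : ∀ k → Doubled (take (suc (size k))) (levelA k) (levelA (suc k))
                    × Doubled (take (suc (size k))) (levelB k) (levelB (suc k))
level-doubled zero =
  pair refl refl (pair refl refl (pair refl refl [])) , pair refl refl (pair refl refl (pair refl refl []))
level-doubled (suc k) with level-doubled k
... | doubledA , doubledB =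
  Doubled-++ (Doubled-map (O n′) (O n) (O-truncate n) doubledB) (Doubled-map (E n′) (E n) (E-truncate n) doubledA) ,
  Doubled-++ (Doubled-map (E n′) (E n) (E-truncate n) doubledB) (Doubled-map (O n′) (O n) (O-truncate n) doubledA)
  where
  n n′ : ℕ
  n = size k
  n′ = size (suc k)

nth-doubled : ∀ {p us ws} → Doubled p us ws → (f g : Word → Word) → (∀ x → f x ≡ g (p x)) →
  ∀ i → map f (nth ws i) ≡ map g (nth us ⌈ i /2⌉)
nth-doubled [] f g fg i = refl
nth-doubled (pair px py d) f g fg zero = refl
nth-doubled (pair {x = x} px py d) f g fg (suc zero) = cong just (trans (fg x) (cong g px))
nth-doubled (pair {y = y} px py d) f g fg (suc (suc zero)) = cong just (trans (fg y) (cong g py))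
nth-doubled (pair px py d) f g fg (suc (suc (suc i))) = nth-doubled d f g fg (suc i)

⌈2i/2⌉≡i : ∀ i → ⌈ 2 * i /2⌉ ≡ i
⌈2i/2⌉≡i i = trans (cong (λ z → ⌈ i + z /2⌉) (+-identityʳ i)) (sym (n≡⌈n+n/2⌉ i))

⌈2i-1/2⌉≡i : ∀ i → 1 ≤ i → ⌈ 2 * i ∸ 1 /2⌉ ≡ i
⌈2i-1/2⌉≡i (suc i) _ = begin
    ⌈ 2 * suc i ∸ 1 /2⌉    ≡⟨ cong ⌈_/2⌉ (trans (cong (i +_) (*-identityˡ (suc i))) (+-suc i i)) ⟩
    ⌈ suc (i + i) /2⌉      ≡⟨ cong suc (sym (n≡⌊n+n/2⌋ i)) ⟩
    suc i                  ∎
  where open ≡-Reasoning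

quarter : ∀ L c → L ≡ c + c + (c + c) → L / 4 ≡ c
quarter L c L≡4c = trans (cong (_/ 4) (trans L≡4c (four-c c))) (m*n/n≡m c 4)
  where
  four-c : ∀ c → c + c + (c + c) ≡ c * 4
  four-c = solve-∀

half : ∀ L c → L ≡ c + c + (c + c) → L / 2 ≡ c + c
half L c L≡4c = trans (cong (_/ 2) (trans L≡4c (two-2c c))) (m*n/n≡m (c + c) 2)
  where
  two-2c : ∀ c → c + c + (c + c) ≡ (c + c) * 2
  two-2c = solve-∀

τ-second-quarter : ∀ L c q → L ≡ c + c + (c + c) → 1 ≤ q → q ≤ c → τ L (c + q) ≡ c + c + c + q
τ-second-quarter zero zero q _ (s≤s _) ()
τ-second-quarter zero (suc c) q () _ _
τ-second-quarter (suc K) c (suc q) L≡4c _ 1+q≤c = begin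
    (c + suc q ∸ 1 + suc K / 2) % suc K + 1
  ≡⟨ cong₂ (λ a b → (a + b) % suc K + 1) (cong (_∸ 1) (+-suc c q)) (half (suc K) c L≡4c) ⟩
    (c + q + (c + c)) % suc K + 1
  ≡⟨ cong (_+ 1) (m<n⇒m%n≡m below) ⟩
    c + q + (c + c) + 1
  ≡⟨ rearrange c q ⟩
    c + c + c + suc q
  ∎
  where
  open ≡-Reasoning
  rearrange : ∀ c q → c + q + (c + c) + 1 ≡ c + c + c + suc q
  rearrange = solve-∀
  regroup : ∀ c q → c + c + c + q ≡ c + q + (c + c)
  regroup = solve-∀
  reassociate : ∀ c → c + c + (c + c) ≡ c + c + c + c
  reassociate = solve-∀
  below : c + q + (c + c) < suc K
  below = subst₂ _<_ (regroup c q) (sym (trans L≡4c (reassociate c)))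
            (subst (_≤ c + c + c + c) (+-suc (c + c + c) q) (+-monoʳ-≤ (c + c + c) 1+q≤c))

τ-third-quarter : ∀ L c r → L ≡ c + c + (c + c) → 1 ≤ r → r ≤ c → τ L (c + (c + r)) ≡ r
τ-third-quarter zero zero r _ (s≤s _) ()
τ-third-quarter zero (suc c) r () _ _
τ-third-quarter (suc K) c (suc r) L≡4c _ 1+r≤c = begin
    (c + (c + suc r) ∸ 1 + suc K / 2) % suc K + 1
  ≡⟨ cong₂ (λ a b → (a + b) % suc K + 1) (cong (_∸ 1) (move-suc c r)) (half (suc K) c L≡4c) ⟩
    (c + (c + r) + (c + c)) % suc K + 1
  ≡⟨ cong (λ z → z % suc K + 1) (trans (regroup c r) (cong (r +_) (sym L≡4c))) ⟩
    (r + suc K) % suc K + 1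
  ≡⟨ cong (_+ 1) (trans ([m+n]%n≡m%n r (suc K)) (m<n⇒m%n≡m below)) ⟩
    r + 1
  ≡⟨ +-comm r 1 ⟩
    suc r
  ∎
  where
  open ≡-Reasoning
  move-suc : ∀ c r → c + (c + suc r) ≡ suc (c + (c + r))
  move-suc = solve-∀
  regroup : ∀ c r → c + (c + r) + (c + c) ≡ r + (c + c + (c + c))
  regroup = solve-∀
  below : r < suc K
  below = subst (suc r ≤_) (sym L≡4c) (≤-trans 1+r≤c (≤-trans (m≤m+n c c) (m≤m+n (c + c) _)))

module NextLevel (k : ℕ) where

  n c : ℕ
  n = size k
  A B U S : List Word
  A = levelA k
  B = levelB k
  U = A ++ B
  S = levelA (suc k) ++ levelB (suc k)
  c = length A

  open SortedLevel (sorted-level k) using (balanced)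

  length-B : length B ≡ c
  length-B = sym balanced

  length-U : length U ≡ c + c
  length-U = trans (length-++ A) (cong (c +_) length-B)

  length-OB : length (List.map (O n) B) ≡ c
  length-OB = trans (length-map (O n) B) length-B

  length-EU : length (List.map (E n) U) ≡ c + c
  length-EU = trans (length-map (E n) U) length-U

  length-OA : length (List.map (O n) A) ≡ c
  length-OA = length-map (O n) A

  S-blocks : S ≡ List.map (O n) B ++ (List.map (E n) U ++ List.map (O n) A)
  S-blocks = begin
      (List.map (O n) B ++ List.map (E n) A) ++ (List.map (E n) B ++ List.map (O n) A)
    ≡⟨ ++-assoc (List.map (O n) B) (List.map (E n) A) _ ⟩
      List.map (O n) B ++ (List.map (E n) A ++ (List.map (E n) B ++ List.map (O n) A))
    ≡⟨ cong (List.map (O n) B ++_) (sym (++-assoc (List.map (E n) A) (List.map (E n) B) _)) ⟩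
      List.map (O n) B ++ ((List.map (E n) A ++ List.map (E n) B) ++ List.map (O n) A)
    ≡⟨ cong (λ z → List.map (O n) B ++ (z ++ List.map (O n) A)) (sym (map-++ (E n) A B)) ⟩
      List.map (O n) B ++ (List.map (E n) U ++ List.map (O n) A)
    ∎
    where open ≡-Reasoning

  length-S : length S ≡ c + c + (c + c)
  length-S = begin
      length S
    ≡⟨ cong length S-blocks ⟩
      length (List.map (O n) B ++ (List.map (E n) U ++ List.map (O n) A))
    ≡⟨ length-++ (List.map (O n) B) ⟩
      length (List.map (O n) B) + length (List.map (E n) U ++ List.map (O n) A)
    ≡⟨ cong (length (List.map (O n) B) +_) (length-++ (List.map (E n) U)) ⟩
      length (List.map (O n) B) + (length (List.map (E n) U) + length (List.map (O n) A))
    ≡⟨ cong₂ (λ a b → a + (b + length (List.map (O n) A))) length-OB length-EU ⟩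
      c + (c + c + length (List.map (O n) A))
    ≡⟨ cong (λ a → c + (c + c + a)) length-OA ⟩
      c + (c + c + c)
    ≡⟨ regroup c ⟩
      c + c + (c + c)
    ∎
    where
    open ≡-Reasoning
    regroup : ∀ c → c + (c + c + c) ≡ c + c + (c + c)
    regroup = solve-∀

  S-at-E : ∀ q → 1 ≤ q → q ≤ c + c → nth S (c + q) ≡ map (E n) (nth U q)
  S-at-E (suc j) _ q≤2c = begin
      nth S (c + suc j)
    ≡⟨ cong₂ (λ z i → nth z (i + suc j)) S-blocks (sym length-OB) ⟩
      nth (List.map (O n) B ++ (List.map (E n) U ++ List.map (O n) A)) (length (List.map (O n) B) + suc j)
    ≡⟨ nth-++ʳ (List.map (O n) B) _ j ⟩
      nth (List.map (E n) U ++ List.map (O n) A) (suc j)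
    ≡⟨ nth-++ˡ (List.map (E n) U) _ (suc j) (subst (suc j ≤_) (sym length-EU) q≤2c) ⟩
      nth (List.map (E n) U) (suc j)
    ≡⟨ nth-map (E n) U (suc j) ⟩
      map (E n) (nth U (suc j))
    ∎
    where open ≡-Reasoning

  S-at-O-A : ∀ q → 1 ≤ q → q ≤ c → nth S (c + c + c + q) ≡ map (O n) (nth U q)
  S-at-O-A (suc j) _ q≤c = begin
      nth S (c + c + c + suc j)
    ≡⟨ cong₂ (λ z i → nth z (i + suc j)) (trans S-blocks (sym (++-assoc (List.map (O n) B) _ _)))
                                          (trans (+-assoc c c c) (sym length-OB-EU)) ⟩
      nth ((List.map (O n) B ++ List.map (E n) U) ++ List.map (O n) A)
          (length (List.map (O n) B ++ List.map (E n) U) + suc j)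
    ≡⟨ nth-++ʳ (List.map (O n) B ++ List.map (E n) U) _ j ⟩
      nth (List.map (O n) A) (suc j)
    ≡⟨ nth-map (O n) A (suc j) ⟩
      map (O n) (nth A (suc j))
    ≡⟨ cong (map (O n)) (sym (nth-++ˡ A B (suc j) q≤c)) ⟩
      map (O n) (nth U (suc j))
    ∎
    where
    open ≡-Reasoning
    length-OB-EU : length (List.map (O n) B ++ List.map (E n) U) ≡ c + (c + c)
    length-OB-EU = trans (length-++ (List.map (O n) B))
      (cong₂ _+_ length-OB length-EU)

  S-at-O-B : ∀ r → 1 ≤ r → r ≤ c → nth S r ≡ map (O n) (nth U (c + r))
  S-at-O-B (suc j) _ r≤c = begin
      nth S (suc j)
    ≡⟨ cong (λ z → nth z (suc j)) S-blocks ⟩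
      nth (List.map (O n) B ++ (List.map (E n) U ++ List.map (O n) A)) (suc j)
    ≡⟨ nth-++ˡ (List.map (O n) B) _ (suc j) (subst (suc j ≤_) (sym length-OB) r≤c) ⟩
      nth (List.map (O n) B) (suc j)
    ≡⟨ nth-map (O n) B (suc j) ⟩
      map (O n) (nth B (suc j))
    ≡⟨ cong (map (O n)) (sym (nth-++ʳ A B j)) ⟩
      map (O n) (nth U (c + suc j))
    ∎
    where open ≡-Reasoning

  θN₁≡E-level : ∀ x → θN₁ (suc (suc k)) x ≡ E n x
  θN₁≡E-level x = trans (θN₁≡E (suc k) x) (cong (λ z → E z x) (sym (size≡ k)))

  θN₂≡O-level : ∀ x → θN₂ (suc (suc k)) x ≡ O n x
  θN₂≡O-level x = trans (θN₂≡O (suc k) x) (cong (λ z → O z x) (sym (size≡ k)))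

  S-doubled : Doubled (take (suc n)) U S
  S-doubled = Doubled-++ (proj₁ (level-doubled k)) (proj₂ (level-doubled k))

  θN₁-at : ∀ i → map (θN₁ (suc (suc k))) (nth S i) ≡ map (E n) (nth U ⌈ i /2⌉)
  θN₁-at i = trans (map-cong θN₁≡E-level (nth S i)) (nth-doubled S-doubled (E n) (E n) (E-prefix n) i)

  θN₂-at : ∀ i → map (θN₂ (suc (suc k))) (nth S i) ≡ map (O n) (nth U ⌈ i /2⌉)
  θN₂-at i = trans (map-cong θN₂≡O-level (nth S i)) (nth-doubled S-doubled (O n) (O n) (O-prefix n) i)

  first-letters : ∀ i → 1 ≤ i → i ≤ length S / 2 →
      (map (θN₁ (suc (suc k))) (nth S (2 * i)) ≡ nth S (length S / 4 + i))
    × (map (θN₁ (suc (suc k))) (nth S (2 * i ∸ 1)) ≡ nth S (length S / 4 + i))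
  first-letters i 1≤i i≤L/2 = via (2 * i) (⌈2i/2⌉≡i i) , via (2 * i ∸ 1) (⌈2i-1/2⌉≡i i 1≤i)
    where
    E-ui : map (E n) (nth U i) ≡ nth S (length S / 4 + i)
    E-ui = trans (sym (S-at-E i 1≤i (subst (i ≤_) (half (length S) c length-S) i≤L/2)))
                 (cong (λ z → nth S (z + i)) (sym (quarter (length S) c length-S)))
    via : ∀ i′ → ⌈ i′ /2⌉ ≡ i → map (θN₁ (suc (suc k))) (nth S i′) ≡ nth S (length S / 4 + i)
    via i′ ⌈i′/2⌉≡i = trans (θN₁-at i′) (trans (cong (λ z → map (E n) (nth U z)) ⌈i′/2⌉≡i) E-ui)

  -- Position τ(c + q) of S holds O(u_q): it lies in the last quarter if q ≤ c and in the
  -- first quarter otherwise.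
  S-at-τ : ∀ q → 1 ≤ q → q ≤ c + c → nth S (τ (length S) (c + q)) ≡ map (O n) (nth U q)
  S-at-τ q 1≤q q≤2c with q ≤? c
  ... | yes q≤c = trans (cong (nth S) (τ-second-quarter (length S) c q length-S 1≤q q≤c)) (S-at-O-A q 1≤q q≤c)
  ... | no q≰c = begin
      nth S (τ (length S) (c + q))        ≡⟨ cong (λ z → nth S (τ (length S) (c + z))) (sym c+r≡q) ⟩
      nth S (τ (length S) (c + (c + r))) ≡⟨ cong (nth S) (τ-third-quarter (length S) c r length-S 1≤r r≤c) ⟩
      nth S r                              ≡⟨ S-at-O-B r 1≤r r≤c ⟩
      map (O n) (nth U (c + r))            ≡⟨ cong (λ z → map (O n) (nth U z)) c+r≡q ⟩
      map (O n) (nth U q)                  ∎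
    where
    open ≡-Reasoning
    r : ℕ
    r = q ∸ c
    c+r≡q : c + r ≡ q
    c+r≡q = m+[n∸m]≡n (<⇒≤ (≰⇒> q≰c))
    1≤r : 1 ≤ r
    1≤r = m<n⇒0<n∸m (≰⇒> q≰c)
    r≤c : r ≤ c
    r≤c = +-cancelˡ-≤ c r c (subst (_≤ c + c) (sym c+r≡q) q≤2c)

  -- Part (2): if w_j is the first letter E(u_q) of θ_N(w_i), q = ⌈i/2⌉, then j = c + q, and
  -- w_{τ(j)} = O(u_q) is the second letter.
  second-letter : ∀ i j → 1 ≤ i → i ≤ length S →
    nth S j ≡ map (θN₁ (suc (suc k))) (nth S i) → nth S (τ (length S) j) ≡ map (θN₂ (suc (suc k))) (nth S i)
  second-letter i j 1≤i i≤L w-j = begin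
      nth S (τ (length S) j)               ≡⟨ cong (λ z → nth S (τ (length S) z)) j≡c+q ⟩
      nth S (τ (length S) (c + q))         ≡⟨ S-at-τ q 1≤q q≤2c ⟩
      map (O n) (nth U q)                  ≡⟨ sym (θN₂-at i) ⟩
      map (θN₂ (suc (suc k))) (nth S i)    ∎
    where
    open ≡-Reasoning
    q : ℕ
    q = ⌈ i /2⌉
    1≤q : 1 ≤ q
    1≤q = ⌈n/2⌉-mono 1≤i
    q≤2c : q ≤ c + c
    q≤2c = subst (q ≤_) (sym (n≡⌈n+n/2⌉ (c + c))) (⌈n/2⌉-mono (subst (i ≤_) length-S i≤L))
    u-q : ∃ λ u → nth U q ≡ just u
    u-q = nth-defined U q 1≤q (subst (q ≤_) (sym length-U) q≤2c)
    j≡c+q : j ≡ c + q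
    j≡c+q = nth-injective S j (c + q) (SortedLevel.sorted (sorted-level (suc k)))
      (trans w-j (trans (θN₁-at i) (cong (map (E n)) (proj₂ u-q))))
      (trans (S-at-E q 1≤q q≤2c) (cong (map (E n)) (proj₂ u-q)))

  S-members : ∀ w → w ∈ S ⇔ In𝒜 (suc (suc k)) w
  S-members w = mk⇔
    (λ w∈S → Equivalence.from 𝒜⇔ (subst (λ z → Factor z w) (size≡ (suc k)) (sound w w∈S)))
    (λ w∈𝒜 → complete w (subst (λ z → Factor z w) (sym (size≡ (suc k))) (Equivalence.to 𝒜⇔ w∈𝒜)))
    where
    open SortedLevel (sorted-level (suc k)) using (sound; complete)
    𝒜⇔ : In𝒜 (suc (suc k)) w ⇔ Factor (2 ^ suc (suc k)) w
    𝒜⇔ = In𝒜⇔Factor (suc (suc k)) w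

  S-unique : ∀ ws → AllPairs _<ₗ_ ws → (∀ w → w ∈ ws ⇔ In𝒜 (suc (suc k)) w) → ws ≡ S
  S-unique ws ws-sorted ws-members = sorted-unique ws S ws-sorted (SortedLevel.sorted (sorted-level (suc k)))
    (λ w w∈ws → Equivalence.from (S-members w) (Equivalence.to (ws-members w) w∈ws))
    (λ w w∈S → Equivalence.from (ws-members w) (Equivalence.to (S-members w) w∈S))

-- The theorem: with m = k + 2, ws is the list S of the next level after level k.
proposition6 : (m : ℕ) → 2 ≤ m →
    (ws : List (List Bool)) →
    AllPairs _<ₗ_ ws →
    ((w : List Bool) → (w ∈ ws) ⇔ In𝒜 m w) →
    ((i : ℕ) → 1 ≤ i → i ≤ length ws / 2 →
        (map (θN₁ m) (nth ws (2 * i)) ≡ nth ws (length ws / 4 + i))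
      × (map (θN₁ m) (nth ws (2 * i ∸ 1)) ≡ nth ws (length ws / 4 + i)))
    × ((i j : ℕ) → 1 ≤ i → i ≤ length ws →
        nth ws j ≡ map (θN₁ m) (nth ws i) →
        nth ws (τ (length ws) j) ≡ map (θN₂ m) (nth ws i))
proposition6 (suc zero) (s≤s ()) _ _ _
proposition6 (suc (suc k)) _ ws ws-sorted ws-members with NextLevel.S-unique k ws ws-sorted ws-members
... | refl = NextLevel.first-letters k , NextLevel.second-letter k
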